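{- Let $p$ and $a$ be positive integers with $\gcd(a,p)=1$, let $r\geq 0$ and $m\geq 1$ be integers. Let $B_{p,r,a,m}(n)$ be the set of partitions of $n$ in which every multiplicity $\mu$ of a part satisfies: $\mu\equiv ja \pmod p$ for some $j\in\{0,1,\ldots,p-1\}$ and $j(pr+a)\le \mu\le j(pr+a)+p(m-1)$. Let $E_{p,r,a,m}(n)$ be the set of partitions of $n$ in which every part divisible by $p$ is not divisible by $pm$, and every part not divisible by $p$ is congruent to $-s(pr+a)\pmod{p^2r+pa}$ for some $s\in\{1,2,\ldots,p-1\}$. Then for all $n\geq 0$, $$|B_{p,r,a,m}(n)|=|E_{p,r,a,m}(n)|.$$
   Context: A partition of $n$ is a finite multiset of positive integers (parts) summing to $n$; the multiplicity of a part is the number of times it occurs (only parts that actually occur, i.e. with positive multiplicity, are considered). -}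

module Defs where

open import Data.Nat using (ℕ; _+_; _*_; _∸_; _≤_; _<_; _%_; NonZero)
open import Data.Nat.Properties using (_≟_)
open import Data.Nat.Divisibility using (_∣_)
open import Data.List using (List; length; filter)
open import Data.Nat.ListAction using (sum)
open import Data.List.Relation.Unary.All using (All)
open import Data.List.Relation.Unary.Linked using (Linked)
open import Data.List.Membership.Propositional using (_∈_)
open import Data.Product using (Σ; _×_; ∃-syntax)
open import Relation.Nullary using (¬_)
open import Relation.Binary.PropositionalEquality using (_≡_)
open import Relation.Binary.Core using (Rel)
open import Level using (0ℓ)

_≥ℕ_ : Rel ℕ 0ℓ
m ≥ℕ n = n ≤ m

record IsPartition (n : ℕ) (xs : List ℕ) : Set where
  field
    nonincreasing : Linked _≥ℕ_ xs
    positive      : All (λ k → 1 ≤ k) xs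
    sums          : sum xs ≡ n

Partition : ℕ → Set
Partition n = Σ (List ℕ) (IsPartition n)

multiplicity : ℕ → List ℕ → ℕ
multiplicity k xs = length (filter (_≟ k) xs)

GoodMultiplicity : (p r a m : ℕ) → .{{NonZero p}} → ℕ → Set
GoodMultiplicity p r a m μ =
  ∃[ j ] (j < p × μ % p ≡ (j * a) % p
               × j * (p * r + a) ≤ μ
               × μ ≤ j * (p * r + a) + p * (m ∸ 1))

B : (p r a m : ℕ) → .{{NonZero p}} → ℕ → Set
B p r a m n = Σ (Partition n) λ π →
  All (λ k → GoodMultiplicity p r a m (multiplicity k (Data.Product.proj₁ π)))
      (Data.Product.proj₁ π)

-- condition on a part for E_{p,r,a,m};
-- "k ≡ -s(pr+a) mod (p²r+pa)" is written  (p²r+pa) ∣ k + s(pr+a)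
GoodPart : (p r a m : ℕ) → ℕ → Set
GoodPart p r a m k =
  (p ∣ k → ¬ (p * m ∣ k)) ×
  (¬ (p ∣ k) → ∃[ s ] (1 ≤ s × s ≤ p ∸ 1 ×
                       (p * p * r + p * a) ∣ k + s * (p * r + a)))

E : (p r a m : ℕ) → ℕ → Set
E p r a m n = Σ (Partition n) λ π → All (GoodPart p r a m) (Data.Product.proj₁ π)

partsB : {p r a m : ℕ} → .{{_ : NonZero p}} → {n : ℕ} → B p r a m n → List ℕ
partsB x = Data.Product.proj₁ (Data.Product.proj₁ x)

partsE : {p r a m n : ℕ} → E p r a m n → List ℕ
partsE x = Data.Product.proj₁ (Data.Product.proj₁ x)

-- Two elements denote the same partition iff their lists of parts
-- (canonical non-increasing lists) are equal; the proof components are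
-- irrelevant, so the bijection is taken with respect to that equality.
record Equinumerous {X Y : Set} (ux : X → List ℕ) (uy : Y → List ℕ) : Set where
  field
    to       : X → Y
    from     : Y → X
    to-cong   : ∀ x x′ → ux x ≡ ux x′ → uy (to x) ≡ uy (to x′)
    from-cong : ∀ y y′ → uy y ≡ uy y′ → ux (from y) ≡ ux (from y′)
    from-to  : ∀ x → ux (from (to x)) ≡ ux x
    to-from  : ∀ y → uy (to (from y)) ≡ uy y

-- Write c = p r + a.  As c is coprime to p, a multiplicity μ is allowed in B exactly when
-- μ = j c + p t with j < p and t < m, and then j and t are unique.  Splitting every
-- multiplicity in this way writes a partition in B as c times a partition with all
-- multiplicities below p plus p times a partition with all multiplicities below m.
-- Glaisher's bijection identifies partitions with multiplicities below b with partitions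
-- having no part divisible by b, preserving the sum: the part l (b ∤ l) receives the
-- multiplicity Σᵢ bⁱ f(bⁱ l), whose base-b digits are the multiplicities f(bⁱ l).  Applied
-- with b = p and b = m, and followed by scaling the parts by c and by p, it produces exactly
-- the partitions in E: their parts prime to p are the c l with p ∤ l, i.e. the parts
-- ≡ −s c (mod p c), and their parts divisible by p are the p k with m ∤ k.

module Submission where

open import Defs
open import Data.Fin using (Fin; toℕ; fromℕ<)
open import Data.Fin.Properties using (any?; toℕ<n; toℕ-fromℕ<)
open import Data.List using (List; []; _∷_; _++_; replicate; length; filter)
open import Data.List.Membership.Propositional using (_∈_)
open import Data.List.Properties
  using (length-++; length-replicate; filter-++; filter-accept; filter-reject; filter-all; filter-none; filter-some)
open import Data.List.Relation.Unary.All as All using (All; []; _∷_)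
open import Data.List.Relation.Unary.All.Properties using (++⁺; replicate⁺)
open import Data.List.Relation.Unary.Any as Any using (here; there)
open import Data.List.Relation.Unary.Linked as Linked using (Linked; []; [-]; _∷_)
open import Data.List.Relation.Unary.Linked.Properties using (Linked⇒All)
open import Data.Nat
open import Data.Nat.Coprimality using (Coprime; coprime-divisor)
open import Data.Nat.Divisibility
open import Data.Nat.DivMod
open import Data.Nat.ListAction using (sum)
open import Data.Nat.ListAction.Properties using (sum-++)
open import Data.Nat.Properties
open import Algebra.Properties.CommutativeSemigroup +-commutativeSemigroup using (interchange; x∙yz≈y∙xz)
open import Data.Nat.Tactic.RingSolver using (solve-∀)
open import Data.Product using (∃-syntax; _×_; _,_; proj₁; proj₂)
open import Data.Sum using (inj₁; inj₂)
open import Function using (_∘_)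
open import Relation.Nullary using (¬_; Dec; yes; no; contradiction)
open import Relation.Binary.PropositionalEquality hiding (J)

1≤m*n⇒1≤m : ∀ {m n} → 1 ≤ m * n → 1 ≤ m
1≤m*n⇒1≤m {suc m} _ = s≤s z≤n

m*n≤o<m⇒n≡0 : ∀ {m n o} → m * n ≤ o → o < m → n ≡ 0
m*n≤o<m⇒n≡0 {m} {zero}  _     _   = refl
m*n≤o<m⇒n≡0 {m} {suc n} m*n≤o o<m = contradiction (≤-trans (m≤m*n m (suc n)) m*n≤o) (<⇒≱ o<m)

∤⇒1≤ : ∀ {d l} → ¬ d ∣ l → 1 ≤ l
∤⇒1≤ {l = zero}  d∤0 = contradiction (_ ∣0) d∤0
∤⇒1≤ {l = suc l} _   = s≤s z≤n

[d*l]/d≡l : ∀ d .{{_ : NonZero d}} l → d * l / d ≡ l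
[d*l]/d≡l d l = trans (cong (_/ d) (*-comm d l)) (m*n/n≡m l d)

[m+n*k]/n≡k : ∀ {m n} .{{_ : NonZero n}} k → m < n → (m + n * k) / n ≡ k
[m+n*k]/n≡k {m} {n} k m<n = begin
  (m + n * k) / n     ≡⟨ +-distrib-/-∣ʳ m (m∣m*n k) ⟩
  m / n + n * k / n   ≡⟨ cong₂ _+_ (m<n⇒m/n≡0 m<n) ([d*l]/d≡l n k) ⟩
  k                   ∎
  where open ≡-Reasoning

[m+n*k]%n≡m : ∀ {m n} .{{_ : NonZero n}} k → m < n → (m + n * k) % n ≡ m
[m+n*k]%n≡m {m} k m<n = trans (%-remove-+ʳ m (m∣m*n k)) (m<n⇒m%n≡m m<n)

%-≡⇒∣∸ : ∀ {m n} d .{{_ : NonZero d}} → n ≤ m → m % d ≡ n % d → d ∣ m ∸ n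
%-≡⇒∣∸ {m} {n} d n≤m m%d≡n%d = divides (m / d ∸ n / d) (begin
  m ∸ n                                        ≡⟨ cong₂ _∸_ (m≡m%n+[m/n]*n m d) (m≡m%n+[m/n]*n n d) ⟩
  (m % d + m / d * d) ∸ (n % d + n / d * d)    ≡⟨ cong (λ z → (m % d + m / d * d) ∸ (z + n / d * d)) (sym m%d≡n%d) ⟩
  (m % d + m / d * d) ∸ (m % d + n / d * d)    ≡⟨ [m+n]∸[m+o]≡n∸o (m % d) (m / d * d) (n / d * d) ⟩
  m / d * d ∸ n / d * d                        ≡⟨ sym (*-distribʳ-∸ d (m / d) (n / d)) ⟩
  (m / d ∸ n / d) * d                          ∎)
  where open ≡-Reasoning

<⇒≤∸1 : ∀ {t m} → t < m → t ≤ m ∸ 1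
<⇒≤∸1 {m = suc _} = ≤-pred

≤∸1⇒< : ∀ {t m} → 1 ≤ m → t ≤ m ∸ 1 → t < m
≤∸1⇒< {m = suc _} _ = s≤s

n<b^n : ∀ {b} → 1 < b → ∀ n → n < b ^ n
n<b^n 1<b zero    = s≤s z≤n
n<b^n {b} 1<b (suc n) = begin-strict
  suc n      ≤⟨ n<b^n 1<b n ⟩
  b ^ n      <⟨ m<m*n (b ^ n) b {{>-nonZero (≤-<-trans z≤n (n<b^n 1<b n))}} 1<b ⟩
  b ^ n * b  ≡⟨ *-comm (b ^ n) b ⟩
  b * b ^ n  ∎
  where open ≤-Reasoning

N<b^N*k : ∀ {b} → 1 < b → ∀ N {k} → 1 ≤ k → N < b ^ N * k
N<b^N*k {b} 1<b N 1≤k =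
  <-≤-trans (n<b^n 1<b N) (≤-trans (≤-reflexive (sym (*-identityʳ (b ^ N)))) (*-monoʳ-≤ (b ^ N) 1≤k))

∑ : ℕ → (ℕ → ℕ) → ℕ
∑ zero    φ = 0
∑ (suc N) φ = φ (suc N) + ∑ N φ

∑-cong : ∀ N {φ ψ} → (∀ k → 1 ≤ k → φ k ≡ ψ k) → ∑ N φ ≡ ∑ N ψ
∑-cong zero    φ≡ψ = refl
∑-cong (suc N) φ≡ψ = cong₂ _+_ (φ≡ψ (suc N) (s≤s z≤n)) (∑-cong N φ≡ψ)

∑-zero : ∀ N {φ} → (∀ k → 1 ≤ k → k ≤ N → φ k ≡ 0) → ∑ N φ ≡ 0
∑-zero zero    φ≡0 = refl
∑-zero (suc N) φ≡0 = cong₂ _+_ (φ≡0 (suc N) (s≤s z≤n) ≤-refl)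
                              (∑-zero N (λ k 1≤k k≤N → φ≡0 k 1≤k (m≤n⇒m≤1+n k≤N)))

∑-+ : ∀ N φ ψ → ∑ N (λ k → φ k + ψ k) ≡ ∑ N φ + ∑ N ψ
∑-+ zero    φ ψ = refl
∑-+ (suc N) φ ψ = trans (cong (φ (suc N) + ψ (suc N) +_) (∑-+ N φ ψ))
                        (interchange (φ (suc N)) (ψ (suc N)) (∑ N φ) (∑ N ψ))

∑-* : ∀ N c φ → ∑ N (λ k → c * φ k) ≡ c * ∑ N φ
∑-* zero    c φ = sym (*-zeroʳ c)
∑-* (suc N) c φ = trans (cong (c * φ (suc N) +_) (∑-* N c φ))
                        (sym (*-distribˡ-+ c (φ (suc N)) (∑ N φ)))

term≤∑ : ∀ N φ {k} → 1 ≤ k → k ≤ N → φ k ≤ ∑ N φ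
term≤∑ zero    φ (s≤s _) ()
term≤∑ (suc N) φ {k} 1≤k k≤1+N with k ≟ suc N
... | yes refl = m≤m+n (φ k) (∑ N φ)
... | no  k≢  = ≤-trans (term≤∑ N φ 1≤k (≤-pred (≤∧≢⇒< k≤1+N k≢))) (m≤n+m (∑ N φ) (φ (suc N)))

∑-split : ∀ K N φ → ∑ (K + N) φ ≡ ∑ N φ + ∑ K (φ ∘ (N +_))
∑-split zero    N φ = sym (+-identityʳ (∑ N φ))
∑-split (suc K) N φ = begin
  φ (suc K + N) + ∑ (K + N) φ                  ≡⟨ cong₂ _+_ (cong φ (+-comm (suc K) N)) (∑-split K N φ) ⟩
  φ (N + suc K) + (∑ N φ + ∑ K (φ ∘ (N +_)))   ≡⟨ x∙yz≈y∙xz (φ (N + suc K)) (∑ N φ) _ ⟩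
  ∑ N φ + ∑ (suc K) (φ ∘ (N +_))               ∎
  where open ≡-Reasoning

∑-extend : ∀ {N M} φ → N ≤ M → (∀ k → N < k → k ≤ M → φ k ≡ 0) → ∑ M φ ≡ ∑ N φ
∑-extend {N} {M} φ N≤M φ≡0 = begin
  ∑ M φ                                  ≡⟨ cong (λ L → ∑ L φ) (sym (m∸n+n≡m N≤M)) ⟩
  ∑ (M ∸ N + N) φ                        ≡⟨ ∑-split (M ∸ N) N φ ⟩
  ∑ N φ + ∑ (M ∸ N) (φ ∘ (N +_))         ≡⟨ cong (∑ N φ +_) (∑-zero (M ∸ N) tail≡0) ⟩
  ∑ N φ + 0                              ≡⟨ +-identityʳ (∑ N φ) ⟩
  ∑ N φ                                  ∎
  where
  open ≡-Reasoning
  tail≡0 : ∀ i → 1 ≤ i → i ≤ M ∸ N → φ (N + i) ≡ 0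
  tail≡0 i 1≤i i≤M∸N = φ≡0 (N + i) (m<m+n N 1≤i) (≤-trans (+-monoʳ-≤ N i≤M∸N) (≤-reflexive (m+[n∸m]≡n N≤M)))

VanishesAbove : ℕ → (ℕ → ℕ) → Set
VanishesAbove N f = ∀ k → N < k → f k ≡ 0

weight : ℕ → (ℕ → ℕ) → ℕ
weight N f = ∑ N (λ k → k * f k)

weight-cong : ∀ N {f g} → f ≗ g → weight N f ≡ weight N g
weight-cong N f≗g = ∑-cong N (λ k _ → cong (k *_) (f≗g k))

term≤weight : ∀ N {f} → VanishesAbove N f → ∀ {k} → 1 ≤ k → k * f k ≤ weight N f
term≤weight N {f} f≡0 {k} 1≤k with k ≤? N
... | yes k≤N = term≤∑ N (λ k → k * f k) 1≤k k≤N
... | no  k≰N = ≤-trans (≤-reflexive (trans (cong (k *_) (f≡0 k (≰⇒> k≰N))) (*-zeroʳ k))) z≤n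

weight-vanishes : ∀ {N g} d → VanishesAbove N g → d * weight N g ≤ N → ∀ l → N < d * l → g l ≡ 0
weight-vanishes {N} {g} d g≡0 d*w≤N l N<dl = m*n≤o<m⇒n≡0 (begin
  d * l * g l        ≡⟨ *-assoc d l (g l) ⟩
  d * (l * g l)      ≤⟨ *-monoʳ-≤ d (term≤weight N g≡0 {l} 1≤l) ⟩
  d * weight N g     ≤⟨ d*w≤N ⟩
  N                  ∎) N<dl
  where
  open ≤-Reasoning
  1≤l : 1 ≤ l
  1≤l = 1≤m*n⇒1≤m {l} (subst (1 ≤_) (*-comm d l) (≤-trans (s≤s z≤n) N<dl))

-- On multiplicity functions, dilate d multiplies every part by d and dropMultiples d
-- deletes the parts divisible by d.
dilate : (d : ℕ) .{{_ : NonZero d}} → (ℕ → ℕ) → ℕ → ℕ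
dilate d A x with d ∣? x
... | yes _ = A (x / d)
... | no  _ = 0

dropMultiples : ℕ → (ℕ → ℕ) → ℕ → ℕ
dropMultiples d f x with d ∣? x
... | yes _ = 0
... | no  _ = f x

module _ (d : ℕ) .{{_ : NonZero d}} (A : ℕ → ℕ) {x : ℕ} where

  dilate-∣ : d ∣ x → dilate d A x ≡ A (x / d)
  dilate-∣ d∣x with d ∣? x
  ... | yes _   = refl
  ... | no  d∤x = contradiction d∣x d∤x

  dilate-∤ : ¬ d ∣ x → dilate d A x ≡ 0
  dilate-∤ d∤x with d ∣? x
  ... | yes d∣x = contradiction d∣x d∤x
  ... | no  _   = refl

  dropMultiples-∣ : d ∣ x → dropMultiples d A x ≡ 0
  dropMultiples-∣ d∣x with d ∣? x
  ... | yes _   = refl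
  ... | no  d∤x = contradiction d∣x d∤x

  dropMultiples-∤ : ¬ d ∣ x → dropMultiples d A x ≡ A x
  dropMultiples-∤ d∤x with d ∣? x
  ... | yes d∣x = contradiction d∣x d∤x
  ... | no  _   = refl

dropMultiples-≡0 : ∀ d {f x} → f x ≡ 0 → dropMultiples d f x ≡ 0
dropMultiples-≡0 d {x = x} fx≡0 with d ∣? x
... | yes _ = refl
... | no  _ = fx≡0

dilate-cong : ∀ d .{{_ : NonZero d}} {A A′} → A ≗ A′ → dilate d A ≗ dilate d A′
dilate-cong d A≗A′ x with d ∣? x
... | yes _ = A≗A′ (x / d)
... | no  _ = refl

dropMultiples-cong : ∀ d {f f′} → f ≗ f′ → dropMultiples d f ≗ dropMultiples d f′
dropMultiples-cong d f≗f′ x with d ∣? x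
... | yes _ = refl
... | no  _ = f≗f′ x

dilate-* : ∀ d .{{_ : NonZero d}} A l → dilate d A (d * l) ≡ A l
dilate-* d A l = trans (dilate-∣ d A (m∣m*n l)) (cong A ([d*l]/d≡l d l))

dilate-vanishes : ∀ d .{{_ : NonZero d}} {N A} → (∀ l → N < d * l → A l ≡ 0) → VanishesAbove N (dilate d A)
dilate-vanishes d {A = A} A≡0 x N<x with d ∣? x
... | yes d∣x = A≡0 (x / d) (subst (_ <_) (sym (m*[n/m]≡n d∣x)) N<x)
... | no  _   = refl

∑-dilate-block : ∀ d .{{_ : NonZero d}} A K → ∑ d (λ i → dilate d A (d * K + i)) ≡ A (suc K)
∑-dilate-block d@(suc d-1) A K = begin
  dilate d A (d * K + d) + ∑ d-1 (λ i → dilate d A (d * K + i))  ≡⟨ cong₂ _+_ top rest ⟩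
  A (suc K) + 0                                                   ≡⟨ +-identityʳ (A (suc K)) ⟩
  A (suc K)                                                       ∎
  where
  open ≡-Reasoning
  top : dilate d A (d * K + d) ≡ A (suc K)
  top = trans (cong (dilate d A) (trans (+-comm (d * K) d) (sym (*-suc d K)))) (dilate-* d A (suc K))
  rest : ∑ d-1 (λ i → dilate d A (d * K + i)) ≡ 0
  rest = ∑-zero d-1 (λ i 1≤i i≤d-1 → dilate-∤ d A (λ d∣dK+i →
           >⇒∤ {{>-nonZero 1≤i}} (s≤s i≤d-1) (∣m+n∣m⇒∣n d∣dK+i (m∣m*n K))))

∑-dilate-* : ∀ d .{{_ : NonZero d}} A K → ∑ (d * K) (dilate d A) ≡ ∑ K A
∑-dilate-* d A zero    = cong (λ L → ∑ L (dilate d A)) (*-zeroʳ d)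
∑-dilate-* d A (suc K) = begin
  ∑ (d * suc K) (dilate d A)                                      ≡⟨ cong (λ L → ∑ L (dilate d A)) (*-suc d K) ⟩
  ∑ (d + d * K) (dilate d A)                                      ≡⟨ ∑-split d (d * K) (dilate d A) ⟩
  ∑ (d * K) (dilate d A) + ∑ d (λ i → dilate d A (d * K + i))     ≡⟨ cong₂ _+_ (∑-dilate-* d A K) (∑-dilate-block d A K) ⟩
  ∑ K A + A (suc K)                                               ≡⟨ +-comm (∑ K A) (A (suc K)) ⟩
  ∑ (suc K) A                                                     ∎
  where open ≡-Reasoning

∑-dilate : ∀ d .{{_ : NonZero d}} N A → (∀ l → N < d * l → A l ≡ 0) → ∑ N (dilate d A) ≡ ∑ N A
∑-dilate d N A A≡0 = trans (sym (∑-extend (dilate d A) (m≤n*m N d) vanish)) (∑-dilate-* d A N)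
  where
  vanish : ∀ k → N < k → k ≤ d * N → dilate d A k ≡ 0
  vanish k N<k _ with d ∣? k
  ... | yes d∣k = A≡0 (k / d) (subst (N <_) (sym (m*[n/m]≡n d∣k)) N<k)
  ... | no  _   = refl

weight-dilate : ∀ d .{{_ : NonZero d}} N A → (∀ l → N < d * l → A l ≡ 0) → weight N (dilate d A) ≡ d * weight N A
weight-dilate d N A A≡0 = begin
  ∑ N (λ k → k * dilate d A k)              ≡⟨ ∑-cong N (λ k _ → scale k) ⟩
  ∑ N (dilate d (λ l → d * (l * A l)))      ≡⟨ ∑-dilate d N _ vanish ⟩
  ∑ N (λ l → d * (l * A l))                 ≡⟨ ∑-* N d (λ l → l * A l) ⟩
  d * weight N A                            ∎
  where
  open ≡-Reasoning
  scale : ∀ k → k * dilate d A k ≡ dilate d (λ l → d * (l * A l)) k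
  scale k with d ∣? k
  ... | yes d∣k = trans (cong (_* A (k / d)) (sym (m*[n/m]≡n d∣k))) (*-assoc d (k / d) (A (k / d)))
  ... | no  _   = *-zeroʳ k
  vanish : ∀ l → N < d * l → d * (l * A l) ≡ 0
  vanish l N<dl rewrite A≡0 l N<dl | *-zeroʳ l = *-zeroʳ d

∑-dropMultiples : ∀ d .{{_ : NonZero d}} N φ → (∀ l → N < d * l → φ (d * l) ≡ 0) →
                  ∑ N φ ≡ ∑ N (dropMultiples d φ) + ∑ N (φ ∘ (d *_))
∑-dropMultiples d N φ φ≡0 = begin
  ∑ N φ                                                        ≡⟨ ∑-cong N (λ x _ → split x) ⟩
  ∑ N (λ x → dropMultiples d φ x + dilate d (φ ∘ (d *_)) x)    ≡⟨ ∑-+ N _ _ ⟩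
  ∑ N (dropMultiples d φ) + ∑ N (dilate d (φ ∘ (d *_)))
    ≡⟨ cong (∑ N (dropMultiples d φ) +_) (∑-dilate d N (φ ∘ (d *_)) φ≡0) ⟩
  ∑ N (dropMultiples d φ) + ∑ N (φ ∘ (d *_))                   ∎
  where
  open ≡-Reasoning
  split : ∀ x → φ x ≡ dropMultiples d φ x + dilate d (φ ∘ (d *_)) x
  split x with d ∣? x
  ... | yes d∣x = cong φ (sym (m*[n/m]≡n d∣x))
  ... | no  _   = sym (+-identityʳ (φ x))

multiplicity-∷-≡ : ∀ k xs → multiplicity k (k ∷ xs) ≡ suc (multiplicity k xs)
multiplicity-∷-≡ k xs = cong length (filter-accept (_≟ k) refl)

multiplicity-∷-≢ : ∀ {k x} xs → x ≢ k → multiplicity k (x ∷ xs) ≡ multiplicity k xs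
multiplicity-∷-≢ {k} xs x≢k = cong length (filter-reject (_≟ k) x≢k)

multiplicity-∈ : ∀ {k} xs → 1 ≤ multiplicity k xs → k ∈ xs
multiplicity-∈ {k} (x ∷ xs) pos with x ≟ k
... | yes refl = here refl
... | no  x≢k  = there (multiplicity-∈ xs (subst (1 ≤_) (multiplicity-∷-≢ xs x≢k) pos))

∈-multiplicity : ∀ {k xs} → k ∈ xs → 1 ≤ multiplicity k xs
∈-multiplicity k∈xs = filter-some (_≟ _) (Any.map sym k∈xs)

multiplicity-++ : ∀ k xs ys → multiplicity k (xs ++ ys) ≡ multiplicity k xs + multiplicity k ys
multiplicity-++ k xs ys = trans (cong length (filter-++ (_≟ k) xs ys)) (length-++ (filter (_≟ k) xs))

multiplicity-replicate : ∀ k r → multiplicity k (replicate r k) ≡ r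
multiplicity-replicate k r = trans (cong length (filter-all (_≟ k) (replicate⁺ r refl))) (length-replicate r)

multiplicity-absent : ∀ k {xs} → All (_≢ k) xs → multiplicity k xs ≡ 0
multiplicity-absent k x≢k = cong length (filter-none (_≟ k) x≢k)

head-multiplicity : ∀ x xs → 1 ≤ multiplicity x (x ∷ xs)
head-multiplicity x xs = ∈-multiplicity {x} {x ∷ xs} (here refl)

head-maximal : ∀ {x xs} → Linked _≥ℕ_ (x ∷ xs) → All (_≤ x) (x ∷ xs)
head-maximal = Linked⇒All (λ y≤x z≤y → ≤-trans z≤y y≤x) ≤-refl

∷-nonincreasing : ∀ {x xs} → All (_≤ x) xs → Linked _≥ℕ_ xs → Linked _≥ℕ_ (x ∷ xs)
∷-nonincreasing []        _   = [-]
∷-nonincreasing (y≤x ∷ _) xs↘ = y≤x ∷ xs↘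

SameMultiplicities : List ℕ → List ℕ → Set
SameMultiplicities xs ys = ∀ k → multiplicity k xs ≡ multiplicity k ys

nonincreasing-head-≤ : ∀ {x xs y ys} → Linked _≥ℕ_ (y ∷ ys) → SameMultiplicities (x ∷ xs) (y ∷ ys) → x ≤ y
nonincreasing-head-≤ {x} {xs} ys↘ same =
  All.lookup (head-maximal ys↘) (multiplicity-∈ _ (subst (1 ≤_) (same x) (head-multiplicity x xs)))

nonincreasing-unique : ∀ {xs ys} → Linked _≥ℕ_ xs → Linked _≥ℕ_ ys → SameMultiplicities xs ys → xs ≡ ys
nonincreasing-unique {[]}     {[]}     _   _   _    = refl
nonincreasing-unique {[]}     {y ∷ ys} _   _   same = contradiction (subst (1 ≤_) (sym (same y)) (head-multiplicity y ys)) λ ()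
nonincreasing-unique {x ∷ xs} {[]}     _   _   same = contradiction (subst (1 ≤_) (same x) (head-multiplicity x xs)) λ ()
nonincreasing-unique {x ∷ xs} {y ∷ ys} xs↘ ys↘ same
  with ≤-antisym (nonincreasing-head-≤ ys↘ same) (nonincreasing-head-≤ xs↘ (sym ∘ same))
... | refl = cong (x ∷_) (nonincreasing-unique (Linked.tail xs↘) (Linked.tail ys↘) same-tail)
  where
  same-tail : SameMultiplicities xs ys
  same-tail k with x ≟ k
  ... | yes refl = suc-injective (trans (sym (multiplicity-∷-≡ k xs)) (trans (same k) (multiplicity-∷-≡ k ys)))
  ... | no  x≢k  = trans (sym (multiplicity-∷-≢ xs x≢k)) (trans (same k) (multiplicity-∷-≢ ys x≢k))

partsOf : ℕ → (ℕ → ℕ) → List ℕ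
partsOf zero    f = []
partsOf (suc N) f = replicate (f (suc N)) (suc N) ++ partsOf N f

multiplicities : List ℕ → ℕ → ℕ
multiplicities xs k = multiplicity k xs

partsOf-cong : ∀ N {f g} → f ≗ g → partsOf N f ≡ partsOf N g
partsOf-cong zero    f≗g = refl
partsOf-cong (suc N) f≗g = cong₂ (λ r rest → replicate r (suc N) ++ rest) (f≗g (suc N)) (partsOf-cong N f≗g)

partsOf-bounded : ∀ N f → All (λ x → 1 ≤ x × x ≤ N) (partsOf N f)
partsOf-bounded zero    f = []
partsOf-bounded (suc N) f =
  ++⁺ (replicate⁺ (f (suc N)) (s≤s z≤n , ≤-refl))
      (All.map (λ (1≤x , x≤N) → 1≤x , m≤n⇒m≤1+n x≤N) (partsOf-bounded N f))

partsOf-nonincreasing : ∀ N f → Linked _≥ℕ_ (partsOf N f)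
partsOf-nonincreasing zero    f = []
partsOf-nonincreasing (suc N) f = prepend (f (suc N))
  where
  prepend : ∀ r → Linked _≥ℕ_ (replicate r (suc N) ++ partsOf N f)
  prepend zero    = partsOf-nonincreasing N f
  prepend (suc r) =
    ∷-nonincreasing (++⁺ (replicate⁺ r ≤-refl) (All.map (m≤n⇒m≤1+n ∘ proj₂) (partsOf-bounded N f))) (prepend r)

sum-replicate : ∀ r x → sum (replicate r x) ≡ r * x
sum-replicate zero    x = refl
sum-replicate (suc r) x = cong (x +_) (sum-replicate r x)

sum-partsOf : ∀ N f → sum (partsOf N f) ≡ weight N f
sum-partsOf zero    f = refl
sum-partsOf (suc N) f = begin
  sum (replicate (f (suc N)) (suc N) ++ partsOf N f)         ≡⟨ sum-++ (replicate (f (suc N)) (suc N)) (partsOf N f) ⟩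
  sum (replicate (f (suc N)) (suc N)) + sum (partsOf N f)
    ≡⟨ cong₂ _+_ (trans (sum-replicate (f (suc N)) (suc N)) (*-comm (f (suc N)) (suc N))) (sum-partsOf N f) ⟩
  suc N * f (suc N) + weight N f                             ∎
  where open ≡-Reasoning

multiplicity-partsOf-≤ : ∀ N f {k} → 1 ≤ k → k ≤ N → multiplicity k (partsOf N f) ≡ f k
multiplicity-partsOf-≤ zero    f (s≤s _) ()
multiplicity-partsOf-≤ (suc N) f {k} 1≤k k≤1+N
  rewrite multiplicity-++ k (replicate (f (suc N)) (suc N)) (partsOf N f) with k ≟ suc N
... | yes refl = trans (cong₂ _+_ (multiplicity-replicate k (f k)) (multiplicity-absent k above-rest)) (+-identityʳ (f k))
  where
  above-rest : All (_≢ k) (partsOf N f)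
  above-rest = All.map (λ (_ , x≤N) → <⇒≢ (s≤s x≤N)) (partsOf-bounded N f)
... | no  k≢1+N = cong₂ _+_ (multiplicity-absent k (replicate⁺ (f (suc N)) (k≢1+N ∘ sym)))
                            (multiplicity-partsOf-≤ N f 1≤k (≤-pred (≤∧≢⇒< k≤1+N k≢1+N)))

multiplicity-partsOf : ∀ N {f} → f 0 ≡ 0 → VanishesAbove N f → multiplicities (partsOf N f) ≗ f
multiplicity-partsOf N {f} f0≡0 f≡0 zero =
  trans (multiplicity-absent 0 (All.map (λ { (1≤x , _) refl → contradiction 1≤x λ () }) (partsOf-bounded N f))) (sym f0≡0)
multiplicity-partsOf N {f} f0≡0 f≡0 (suc k) with suc k ≤? N
... | yes k<N = multiplicity-partsOf-≤ N f (s≤s z≤n) k<N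
... | no  k≮N = trans (multiplicity-absent (suc k) (All.map (λ { (_ , x≤N) refl → k≮N x≤N }) (partsOf-bounded N f)))
                      (sym (f≡0 (suc k) (≰⇒> k≮N)))

record IsMultiplicities (n : ℕ) (f : ℕ → ℕ) : Set where
  field
    at-zero  : f 0 ≡ 0
    vanishes : VanishesAbove n f
    weighs   : weight n f ≡ n

partsOf-isPartition : ∀ {n f} → IsMultiplicities n f → IsPartition n (partsOf n f)
partsOf-isPartition {n} {f} f-mult = record
  { nonincreasing = partsOf-nonincreasing n f
  ; positive      = All.map proj₁ (partsOf-bounded n f)
  ; sums          = trans (sum-partsOf n f) (IsMultiplicities.weighs f-mult)
  }

parts≤sum : ∀ xs → All (_≤ sum xs) xs
parts≤sum []       = []
parts≤sum (x ∷ xs) = m≤m+n x (sum xs) ∷ All.map (λ y≤ → ≤-trans y≤ (m≤n+m (sum xs) x)) (parts≤sum xs)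

module _ {n : ℕ} {xs : List ℕ} (xs-part : IsPartition n xs) where
  open IsPartition xs-part

  parts≤n : All (_≤ n) xs
  parts≤n = subst (λ s → All (_≤ s) xs) sums (parts≤sum xs)

  multiplicities-at-zero : multiplicities xs 0 ≡ 0
  multiplicities-at-zero = multiplicity-absent 0 (All.map (λ { 1≤x refl → contradiction 1≤x λ () }) positive)

  multiplicities-vanish : VanishesAbove n (multiplicities xs)
  multiplicities-vanish k n<k = multiplicity-absent k (All.map (λ { x≤n refl → <⇒≱ n<k x≤n }) parts≤n)

  partsOf-multiplicities : partsOf n (multiplicities xs) ≡ xs
  partsOf-multiplicities =
    nonincreasing-unique (partsOf-nonincreasing n _) nonincreasing
                         (multiplicity-partsOf n multiplicities-at-zero multiplicities-vanish)

  multiplicities-isMultiplicities : IsMultiplicities n (multiplicities xs)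
  multiplicities-isMultiplicities = record
    { at-zero  = multiplicities-at-zero
    ; vanishes = multiplicities-vanish
    ; weighs   = trans (sym (sum-partsOf n _)) (trans (cong sum partsOf-multiplicities) sums)
    }

-- Glaisher's bijection

record SmallMultiplicities (b N : ℕ) (f : ℕ → ℕ) : Set where
  field
    at-zero  : f 0 ≡ 0
    vanishes : VanishesAbove N f
    below    : ∀ k → f k < b

record AvoidsMultiples (b N : ℕ) (g : ℕ → ℕ) : Set where
  field
    on-multiples : ∀ k → b ∣ k → g k ≡ 0
    vanishes     : VanishesAbove N g

module Glaisher (b : ℕ) .{{_ : NonZero b}} where

  -- shiftDown F g (bᵉ l) = g l / bᵉ for b ∤ l and e ≤ F, so the multiplicity of bᵉ l
  -- in unglaisher N g is the e-th base-b digit of g l.  The fuel suc N suffices as bᴺ⁺¹ > N.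
  fromDigits : ℕ → (ℕ → ℕ) → ℕ → ℕ
  fromDigits zero    f k = 0
  fromDigits (suc F) f k = f k + b * fromDigits F f (b * k)

  shiftDown : ℕ → (ℕ → ℕ) → ℕ → ℕ
  shiftDown zero    g k = g k
  shiftDown (suc F) g k with b ∣? k
  ... | yes _ = shiftDown F g (k / b) / b
  ... | no  _ = g k

  glaisher : ℕ → (ℕ → ℕ) → ℕ → ℕ
  glaisher N f = dropMultiples b (fromDigits (suc N) f)

  unglaisher : ℕ → (ℕ → ℕ) → ℕ → ℕ
  unglaisher N g k = shiftDown (suc N) g k % b

  fromDigits-cong : ∀ F {f f′} → f ≗ f′ → fromDigits F f ≗ fromDigits F f′
  fromDigits-cong zero    f≗f′ k = refl
  fromDigits-cong (suc F) f≗f′ k = cong₂ (λ x y → x + b * y) (f≗f′ k) (fromDigits-cong F f≗f′ (b * k))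

  shiftDown-cong : ∀ F {g g′} → g ≗ g′ → shiftDown F g ≗ shiftDown F g′
  shiftDown-cong zero    g≗g′ k = g≗g′ k
  shiftDown-cong (suc F) g≗g′ k with b ∣? k
  ... | yes _ = cong (_/ b) (shiftDown-cong F g≗g′ (k / b))
  ... | no  _ = g≗g′ k

  glaisher-cong : ∀ N {f f′} → f ≗ f′ → glaisher N f ≗ glaisher N f′
  glaisher-cong N f≗f′ k with b ∣? k
  ... | yes _ = refl
  ... | no  _ = fromDigits-cong (suc N) f≗f′ k

  unglaisher-cong : ∀ N {g g′} → g ≗ g′ → unglaisher N g ≗ unglaisher N g′
  unglaisher-cong N g≗g′ k = cong (_% b) (shiftDown-cong (suc N) g≗g′ k)

  shiftDown-∣ : ∀ F g {k} → b ∣ k → shiftDown (suc F) g k ≡ shiftDown F g (k / b) / b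
  shiftDown-∣ F g {k} b∣k with b ∣? k
  ... | yes _   = refl
  ... | no  b∤k = contradiction b∣k b∤k

  shiftDown-∤ : ∀ F g {k} → ¬ b ∣ k → shiftDown (suc F) g k ≡ g k
  shiftDown-∤ F g {k} b∤k with b ∣? k
  ... | yes b∣k = contradiction b∣k b∤k
  ... | no  _   = refl

  fromDigits-vanishes : ∀ {N f} → VanishesAbove N f → ∀ F → VanishesAbove N (fromDigits F f)
  fromDigits-vanishes f≡0 zero    k N<k = refl
  fromDigits-vanishes f≡0 (suc F) k N<k
    rewrite f≡0 k N<k | fromDigits-vanishes f≡0 F (b * k) (<-≤-trans N<k (m≤n*m k b)) = *-zeroʳ b

  glaisher-avoids : ∀ {N f} → VanishesAbove N f → AvoidsMultiples b N (glaisher N f)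
  glaisher-avoids {N} {f} f≡0 = record
    { on-multiples = λ k → dropMultiples-∣ b _
    ; vanishes     = λ k N<k → dropMultiples-≡0 b (fromDigits-vanishes f≡0 (suc N) k N<k)
    }

  shiftDown-bounded : ∀ {N g} → (∀ l → 1 ≤ l → l * g l ≤ N) → ∀ F {k} → 1 ≤ k → k * shiftDown F g k ≤ N
  shiftDown-bounded bound zero    1≤k = bound _ 1≤k
  shiftDown-bounded {N} {g} bound (suc F) {k} 1≤k with b ∣? k
  ... | no  _ = bound k 1≤k
  ... | yes (divides k′ refl) = begin
    k′ * b * (shiftDown F g (k′ * b / b) / b)  ≡⟨ cong (λ z → k′ * b * (shiftDown F g z / b)) (m*n/n≡m k′ b) ⟩
    k′ * b * (shiftDown F g k′ / b)            ≡⟨ regroup k′ b (shiftDown F g k′ / b) ⟩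
    k′ * (shiftDown F g k′ / b * b)            ≤⟨ *-monoʳ-≤ k′ (m/n*n≤m (shiftDown F g k′) b) ⟩
    k′ * shiftDown F g k′                      ≤⟨ shiftDown-bounded bound F {k′} (1≤m*n⇒1≤m 1≤k) ⟩
    N                                          ∎
    where
    open ≤-Reasoning
    regroup : ∀ x y z → x * y * z ≡ x * (z * y)
    regroup = solve-∀

  shiftDown-vanishes : ∀ {N g} → (∀ l → 1 ≤ l → l * g l ≤ N) → ∀ F → VanishesAbove N (shiftDown F g)
  shiftDown-vanishes bound F k N<k = m*n≤o<m⇒n≡0 (shiftDown-bounded bound F (≤-trans (s≤s z≤n) N<k)) N<k

  shiftDown-at-zero : ∀ {g} → g 0 ≡ 0 → ∀ F → shiftDown F g 0 ≡ 0
  shiftDown-at-zero g0≡0 zero = g0≡0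
  shiftDown-at-zero {g} g0≡0 (suc F) = begin
    shiftDown (suc F) g 0       ≡⟨ shiftDown-∣ F g (b ∣0) ⟩
    shiftDown F g (0 / b) / b   ≡⟨ cong (λ z → shiftDown F g z / b) (0/n≡0 b) ⟩
    shiftDown F g 0 / b         ≡⟨ cong (_/ b) (shiftDown-at-zero g0≡0 F) ⟩
    0 / b                       ≡⟨ 0/n≡0 b ⟩
    0                           ∎
    where open ≡-Reasoning

  unglaisher-small : ∀ {N g} → AvoidsMultiples b N g → weight N g ≤ N → SmallMultiplicities b N (unglaisher N g)
  unglaisher-small {N} {g} g-avoids weight≤N = record
    { at-zero  = trans (cong (_% b) (shiftDown-at-zero (on-multiples 0 (b ∣0)) (suc N))) (m<n⇒m%n≡m (>-nonZero⁻¹ b))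
    ; vanishes = λ k N<k → trans (cong (_% b) (shiftDown-vanishes bound (suc N) k N<k)) (m<n⇒m%n≡m (>-nonZero⁻¹ b))
    ; below    = λ k → m%n<n _ b
    }
    where
    open AvoidsMultiples g-avoids
    bound : ∀ l → 1 ≤ l → l * g l ≤ N
    bound l 1≤l = ≤-trans (term≤weight N vanishes 1≤l) weight≤N

  b^F*[b*k]≡b^[1+F]*k : ∀ F k → b ^ F * (b * k) ≡ b ^ suc F * k
  b^F*[b*k]≡b^[1+F]*k F k = trans (sym (*-assoc (b ^ F) b k)) (cong (_* k) (*-comm (b ^ F) b))

  k*b<b^[1+F]⇒k<b^F : ∀ {k} F → k * b < b ^ suc F → k < b ^ F
  k*b<b^[1+F]⇒k<b^F {k} F k*b<b^[1+F] = *-cancelʳ-< b k (b ^ F) (subst (k * b <_) (*-comm b (b ^ F)) k*b<b^[1+F])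

  -- H k is the number with base-b digits f k, f (b k), f (b² k), …
  IsExpansion : (ℕ → ℕ) → (ℕ → ℕ) → Set
  IsExpansion f H = ∀ k → 1 ≤ k → H k ≡ f k + b * H (b * k)

  module _ {f H} (f<b : ∀ k → f k < b) (H-exp : IsExpansion f H) where

    expansion-/ : ∀ {k} → 1 ≤ k → H k / b ≡ H (b * k)
    expansion-/ {k} 1≤k = trans (cong (_/ b) (H-exp k 1≤k)) ([m+n*k]/n≡k (H (b * k)) (f<b k))

    expansion-% : ∀ {k} → 1 ≤ k → H k % b ≡ f k
    expansion-% {k} 1≤k = trans (cong (_% b) (H-exp k 1≤k)) ([m+n*k]%n≡m (H (b * k)) (f<b k))

    shiftDown-expansion : ∀ F {k} → 1 ≤ k → k < b ^ F → shiftDown F (dropMultiples b H) k ≡ H k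
    shiftDown-expansion zero    1≤k k<1 = contradiction k<1 (≤⇒≯ 1≤k)
    shiftDown-expansion (suc F) {k} 1≤k k<b^[1+F] with b ∣? k
    ... | no  b∤k = dropMultiples-∤ b H b∤k
    ... | yes (divides k′ refl) = begin
      shiftDown F (dropMultiples b H) (k′ * b / b) / b
        ≡⟨ cong (λ z → shiftDown F (dropMultiples b H) z / b) (m*n/n≡m k′ b) ⟩
      shiftDown F (dropMultiples b H) k′ / b            ≡⟨ cong (_/ b) (shiftDown-expansion F 1≤k′ k′<b^F) ⟩
      H k′ / b                                          ≡⟨ expansion-/ 1≤k′ ⟩
      H (b * k′)                                        ≡⟨ cong H (*-comm b k′) ⟩
      H (k′ * b)                                        ∎
      where
      open ≡-Reasoning
      1≤k′ : 1 ≤ k′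
      1≤k′ = 1≤m*n⇒1≤m 1≤k
      k′<b^F : k′ < b ^ F
      k′<b^F = k*b<b^[1+F]⇒k<b^F F k<b^[1+F]

  fromDigits-expansion : ∀ {f H} → IsExpansion f H →
                         ∀ F {k} → 1 ≤ k → H (b ^ F * k) ≡ 0 → fromDigits F f k ≡ H k
  fromDigits-expansion {H = H} H-exp zero    {k} 1≤k H≡0 = sym (trans (cong H (sym (*-identityˡ k))) H≡0)
  fromDigits-expansion {f} {H} H-exp (suc F) {k} 1≤k H≡0 = begin
    f k + b * fromDigits F f (b * k)   ≡⟨ cong (λ z → f k + b * z) (fromDigits-expansion H-exp F (≤-trans 1≤k (m≤n*m k b))
                                                                       (trans (cong H (b^F*[b*k]≡b^[1+F]*k F k)) H≡0)) ⟩
    f k + b * H (b * k)                ≡⟨ sym (H-exp k 1≤k) ⟩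
    H k                                ∎
    where open ≡-Reasoning

  fromDigits-stable : ∀ F f k → f (b ^ F * k) ≡ 0 → fromDigits (suc F) f k ≡ fromDigits F f k
  fromDigits-stable zero    f k f≡0 rewrite *-zeroʳ b | +-identityʳ (f k) = trans (cong f (sym (*-identityˡ k))) f≡0
  fromDigits-stable (suc F) f k f≡0 =
    cong (λ z → f k + b * z) (fromDigits-stable F f (b * k) (trans (cong f (b^F*[b*k]≡b^[1+F]*k F k)) f≡0))

  shiftDown-stable : ∀ F g {k} → 1 ≤ k → k < b ^ F → shiftDown (suc F) g k ≡ shiftDown F g k
  shiftDown-stable zero    g 1≤k k<1 = contradiction k<1 (≤⇒≯ 1≤k)
  shiftDown-stable (suc F) g {k} 1≤k k<b^[1+F] with b ∣? k
  ... | no  _ = refl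
  ... | yes (divides k′ refl) = begin
    shiftDown (suc F) g (k′ * b / b) / b  ≡⟨ cong (λ z → shiftDown (suc F) g z / b) (m*n/n≡m k′ b) ⟩
    shiftDown (suc F) g k′ / b
      ≡⟨ cong (_/ b) (shiftDown-stable F g (1≤m*n⇒1≤m 1≤k) (k*b<b^[1+F]⇒k<b^F F k<b^[1+F])) ⟩
    shiftDown F g k′ / b                  ≡⟨ cong (λ z → shiftDown F g z / b) (sym (m*n/n≡m k′ b)) ⟩
    shiftDown F g (k′ * b / b) / b        ∎
    where open ≡-Reasoning
  module Nondegenerate (1<b : 1 < b) where

    fromDigits-isExpansion : ∀ {N f} → VanishesAbove N f → IsExpansion f (fromDigits (suc N) f)
    fromDigits-isExpansion {N} {f} f≡0 k 1≤k =
      cong (λ z → f k + b * z) (sym (fromDigits-stable N f (b * k) (f≡0 _ (N<b^N*k 1<b N (≤-trans 1≤k (m≤n*m k b))))))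

    -- ψ k = k f k + ψ (b k) for ψ k = k H k; summing, the parts prime to b carry the weight of f.
    weight-glaisher : ∀ {N f} → VanishesAbove N f → weight N (glaisher N f) ≡ weight N f
    weight-glaisher {N} {f} f≡0 = +-cancelʳ-≡ (∑ N (ψ ∘ (b *_))) _ _ (begin
      weight N (glaisher N f) + ∑ N (ψ ∘ (b *_))
        ≡⟨ cong (_+ ∑ N (ψ ∘ (b *_))) (∑-cong N (λ k _ → times-dropMultiples k)) ⟩
      ∑ N (dropMultiples b ψ) + ∑ N (ψ ∘ (b *_))  ≡⟨ sym (∑-dropMultiples b N ψ ψ[b*l]≡0) ⟩
      ∑ N ψ                                       ≡⟨ ∑-cong N ψ-step ⟩
      ∑ N (λ k → k * f k + ψ (b * k))             ≡⟨ ∑-+ N (λ k → k * f k) (ψ ∘ (b *_)) ⟩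
      weight N f + ∑ N (ψ ∘ (b *_))               ∎)
      where
      open ≡-Reasoning
      H : ℕ → ℕ
      H = fromDigits (suc N) f
      ψ : ℕ → ℕ
      ψ k = k * H k
      times-dropMultiples : ∀ k → k * glaisher N f k ≡ dropMultiples b ψ k
      times-dropMultiples k with b ∣? k
      ... | yes _ = *-zeroʳ k
      ... | no  _ = refl
      ψ[b*l]≡0 : ∀ l → N < b * l → ψ (b * l) ≡ 0
      ψ[b*l]≡0 l N<bl = trans (cong (b * l *_) (fromDigits-vanishes f≡0 (suc N) (b * l) N<bl)) (*-zeroʳ (b * l))
      distribute : ∀ k x c y → k * (x + c * y) ≡ k * x + c * k * y
      distribute = solve-∀
      ψ-step : ∀ k → 1 ≤ k → ψ k ≡ k * f k + ψ (b * k)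
      ψ-step k 1≤k = trans (cong (k *_) (fromDigits-isExpansion f≡0 k 1≤k)) (distribute k (f k) b (H (b * k)))

    unglaisher-glaisher : ∀ {N f} → SmallMultiplicities b N f → weight N f ≤ N → unglaisher N (glaisher N f) ≗ f
    unglaisher-glaisher {N} {f} f-small weight≤N = agree
      where
      open SmallMultiplicities f-small
      g-small : SmallMultiplicities b N (unglaisher N (glaisher N f))
      g-small = unglaisher-small (glaisher-avoids vanishes) (subst (_≤ N) (sym (weight-glaisher vanishes)) weight≤N)
      agree : unglaisher N (glaisher N f) ≗ f
      agree zero = trans (SmallMultiplicities.at-zero g-small) (sym at-zero)
      agree (suc k) with suc k ≤? N
      ... | no  k≮N = trans (SmallMultiplicities.vanishes g-small (suc k) (≰⇒> k≮N))
                            (sym (vanishes (suc k) (≰⇒> k≮N)))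
      ... | yes k<N = trans (cong (_% b) (shiftDown-expansion below H-exp (suc N) (s≤s z≤n) k<b^[1+N]))
                            (expansion-% below H-exp (s≤s z≤n))
        where
        H-exp : IsExpansion f (fromDigits (suc N) f)
        H-exp = fromDigits-isExpansion vanishes
        k<b^[1+N] : suc k < b ^ suc N
        k<b^[1+N] = <-trans (s≤s k<N) (n<b^n 1<b (suc N))

    module _ {N g} (g-avoids : AvoidsMultiples b N g) (weight≤N : weight N g ≤ N) where
      open AvoidsMultiples g-avoids

      private
        Q : ℕ → ℕ
        Q = shiftDown (suc N) g

        bound : ∀ l → 1 ≤ l → l * g l ≤ N
        bound l 1≤l = ≤-trans (term≤weight N vanishes 1≤l) weight≤N

        shiftDown-step : ∀ {k} → 1 ≤ k → Q (b * k) ≡ Q k / b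
        shiftDown-step {k} 1≤k = begin
          Q (b * k)                       ≡⟨ shiftDown-∣ N g (m∣m*n k) ⟩
          shiftDown N g (b * k / b) / b   ≡⟨ cong (λ z → shiftDown N g z / b) ([d*l]/d≡l b k) ⟩
          shiftDown N g k / b             ≡⟨ cong (_/ b) shorter ⟩
          Q k / b                         ∎
          where
          open ≡-Reasoning
          shorter : shiftDown N g k ≡ Q k
          shorter with k ≤? N
          ... | yes k≤N = sym (shiftDown-stable N g 1≤k (<-≤-trans (s≤s k≤N) (n<b^n 1<b N)))
          ... | no  k≰N = trans (shiftDown-vanishes bound N k (≰⇒> k≰N))
                                (sym (shiftDown-vanishes bound (suc N) k (≰⇒> k≰N)))

        shiftDown-isExpansion : IsExpansion (unglaisher N g) Q
        shiftDown-isExpansion k 1≤k = begin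
          Q k                        ≡⟨ m≡m%n+[m/n]*n (Q k) b ⟩
          Q k % b + Q k / b * b      ≡⟨ cong (Q k % b +_) (*-comm (Q k / b) b) ⟩
          Q k % b + b * (Q k / b)    ≡⟨ cong (λ z → Q k % b + b * z) (sym (shiftDown-step 1≤k)) ⟩
          Q k % b + b * Q (b * k)    ∎
          where open ≡-Reasoning

      glaisher-unglaisher : glaisher N (unglaisher N g) ≗ g
      glaisher-unglaisher l with b ∣? l
      ... | yes b∣l = sym (on-multiples l b∣l)
      ... | no  b∤l = begin
        fromDigits (suc N) (unglaisher N g) l   ≡⟨ fromDigits-expansion shiftDown-isExpansion (suc N) 1≤l Q-far ⟩
        Q l                                      ≡⟨ shiftDown-∤ N g b∤l ⟩
        g l                                      ∎
        where
        open ≡-Reasoning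
        1≤l : 1 ≤ l
        1≤l = ∤⇒1≤ b∤l
        Q-far : Q (b ^ suc N * l) ≡ 0
        Q-far = shiftDown-vanishes bound (suc N) _ (<-trans (n<1+n N) (N<b^N*k 1<b (suc N) 1≤l))

  -- For b = 1 all functions in sight vanish.
  private
    b≤1⇒below≡0 : ¬ 1 < b → ∀ {x} → x < b → x ≡ 0
    b≤1⇒below≡0 b≯1 {zero}  _     = refl
    b≤1⇒below≡0 b≯1 {suc x} 1+x<b = contradiction (≤-<-trans (s≤s z≤n) 1+x<b) b≯1

    b≤1⇒∣ : ¬ 1 < b → ∀ l → b ∣ l
    b≤1⇒∣ b≯1 l = subst (_∣ l) (sym (≤-antisym (≮⇒≥ b≯1) (>-nonZero⁻¹ b))) (1∣ l)

  weight-glaisher : ∀ {N f} → SmallMultiplicities b N f → weight N (glaisher N f) ≡ weight N f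
  weight-glaisher {N} {f} f-small with 1 <? b
  ... | yes 1<b = Nondegenerate.weight-glaisher 1<b (SmallMultiplicities.vanishes f-small)
  ... | no  b≯1 = weight-cong N (λ k → trans (dropMultiples-∣ b _ (b≤1⇒∣ b≯1 k))
                                             (sym (b≤1⇒below≡0 b≯1 (SmallMultiplicities.below f-small k))))

  unglaisher-glaisher : ∀ {N f} → SmallMultiplicities b N f → weight N f ≤ N → unglaisher N (glaisher N f) ≗ f
  unglaisher-glaisher f-small weight≤N k with 1 <? b
  ... | yes 1<b = Nondegenerate.unglaisher-glaisher 1<b f-small weight≤N k
  ... | no  b≯1 = trans (b≤1⇒below≡0 b≯1 (m%n<n _ b))
                        (sym (b≤1⇒below≡0 b≯1 (SmallMultiplicities.below f-small k)))

  glaisher-unglaisher : ∀ {N g} → AvoidsMultiples b N g → weight N g ≤ N → glaisher N (unglaisher N g) ≗ g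
  glaisher-unglaisher g-avoids weight≤N l with 1 <? b
  ... | yes 1<b = Nondegenerate.glaisher-unglaisher 1<b g-avoids weight≤N l
  ... | no  b≯1 = trans (dropMultiples-∣ b _ (b≤1⇒∣ b≯1 l))
                        (sym (AvoidsMultiples.on-multiples g-avoids l (b≤1⇒∣ b≯1 l)))

module Correspondence (p r a m : ℕ) .{{_ : NonZero p}} (1≤a : 1 ≤ a) (a⊥p : Coprime a p) (1≤m : 1 ≤ m) where

  c : ℕ
  c = p * r + a

  instance
    c≢0 : NonZero c
    c≢0 = >-nonZero (≤-trans 1≤a (m≤n+m a (p * r)))

    m≢0 : NonZero m
    m≢0 = >-nonZero 1≤m

  module P = Glaisher p
  module M = Glaisher m

  p⊥c : Coprime p c
  p⊥c (d∣p , d∣c) = a⊥p (∣m+n∣m⇒∣n d∣c (∣m⇒∣m*n r d∣p) , d∣p)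

  p∣c*l⇒p∣l : ∀ {l} → p ∣ c * l → p ∣ l
  p∣c*l⇒p∣l = coprime-divisor p⊥c

  p*p*r+p*a≡p*c : p * p * r + p * a ≡ p * c
  p*p*r+p*a≡p*c = trans (cong (_+ p * a) (*-assoc p p r)) (sym (*-distribˡ-+ p (p * r) a))

  j*c%p≡j*a%p : ∀ j → (j * c) % p ≡ (j * a) % p
  j*c%p≡j*a%p j = trans (cong (_% p) (expand j p r a)) ([m+kn]%n≡m%n (j * a) (j * r) p)
    where
    expand : ∀ j p r a → j * (p * r + a) ≡ j * a + j * r * p
    expand = solve-∀

  Splits : ℕ → ℕ → Set
  Splits μ j = ∃[ t ] μ ≡ j * c + p * t

  splits? : ∀ μ j → Dec (Splits μ j)
  splits? μ j with j * c ≤? μ | p ∣? (μ ∸ j * c)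
  ... | yes jc≤μ | yes (divides t μ∸jc≡t*p) =
    yes (t , trans (sym (m+[n∸m]≡n jc≤μ)) (cong (j * c +_) (trans μ∸jc≡t*p (*-comm t p))))
  ... | yes _    | no  p∤μ∸jc = no λ { (t , refl) →
    p∤μ∸jc (subst (p ∣_) (sym (m+n∸m≡n (j * c) (p * t))) (m∣m*n t)) }
  ... | no  jc≰μ | _          = no λ { (t , refl) → jc≰μ (m≤m+n (j * c) (p * t)) }

  private
    splits-unique-+ : ∀ {j o t₁ t₂} → j + o < p → j * c + p * t₁ ≡ (j + o) * c + p * t₂ → o ≡ 0
    splits-unique-+ {o = zero}                    _      _  = refl
    splits-unique-+ {j} {o = suc o} {t₁} {t₂} j+o<p eq = contradiction p∣1+o (>⇒∤ 1+o<p)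
      where
      regroup : ∀ j o′ c p t → (j + o′) * c + p * t ≡ j * c + (p * t + c * o′)
      regroup = solve-∀
      p*t₁≡ : p * t₁ ≡ p * t₂ + c * suc o
      p*t₁≡ = +-cancelˡ-≡ (j * c) _ _ (trans eq (regroup j (suc o) c p t₂))
      p∣1+o : p ∣ suc o
      p∣1+o = coprime-divisor p⊥c (∣m+n∣m⇒∣n (subst (p ∣_) p*t₁≡ (m∣m*n t₁)) (m∣m*n t₂))
      1+o<p : suc o < p
      1+o<p = ≤-<-trans (s≤s (m≤n+m o j)) (subst (_< p) (+-suc j o) j+o<p)

    splits-unique-≤ : ∀ {j j′ t t′} → j ≤ j′ → j′ < p → j * c + p * t ≡ j′ * c + p * t′ → j ≡ j′
    splits-unique-≤ {j} {j′} {t} {t′} j≤j′ j′<p eq =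
      trans (sym (+-identityʳ j)) (trans (cong (j +_) (sym o≡0)) j+o≡j′)
      where
      j+o≡j′ : j + (j′ ∸ j) ≡ j′
      j+o≡j′ = m+[n∸m]≡n j≤j′
      o≡0 : j′ ∸ j ≡ 0
      o≡0 = splits-unique-+ (subst (_< p) (sym j+o≡j′) j′<p)
                            (subst (λ z → j * c + p * t ≡ z * c + p * t′) (sym j+o≡j′) eq)

  splits-unique : ∀ {μ j₁ j₂} → j₁ < p → j₂ < p → Splits μ j₁ → Splits μ j₂ → j₁ ≡ j₂
  splits-unique {j₁ = j₁} {j₂} j₁<p j₂<p (t₁ , μ≡₁) (t₂ , μ≡₂) with ≤-total j₁ j₂
  ... | inj₁ j₁≤j₂ = splits-unique-≤ j₁≤j₂ j₂<p (trans (sym μ≡₁) μ≡₂)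
  ... | inj₂ j₂≤j₁ = sym (splits-unique-≤ j₂≤j₁ j₁<p (trans (sym μ≡₂) μ≡₁))

  -- The junk value 0 is returned when μ does not split.
  jIndex : ℕ → ℕ
  jIndex μ with any? (λ (j : Fin p) → splits? μ (toℕ j))
  ... | yes (j , _) = toℕ j
  ... | no  _       = 0

  tIndex : ℕ → ℕ
  tIndex μ = (μ ∸ jIndex μ * c) / p

  jIndex-spec : ∀ {μ j} → j < p → Splits μ j → jIndex μ ≡ j
  jIndex-spec {μ} {j} j<p μ-splits with any? (λ (j : Fin p) → splits? μ (toℕ j))
  ... | yes (i , μ-splitsᵢ) = splits-unique (toℕ<n i) j<p μ-splitsᵢ μ-splits
  ... | no  none            = contradiction (fromℕ< j<p , subst (Splits μ) (sym (toℕ-fromℕ< j<p)) μ-splits) none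

  index-spec : ∀ {j t} → j < p → jIndex (j * c + p * t) ≡ j × tIndex (j * c + p * t) ≡ t
  index-spec {j} {t} j<p = j≡ , (begin
    (j * c + p * t ∸ jIndex (j * c + p * t) * c) / p   ≡⟨ cong (λ z → (j * c + p * t ∸ z * c) / p) j≡ ⟩
    (j * c + p * t ∸ j * c) / p                        ≡⟨ cong (_/ p) (m+n∸m≡n (j * c) (p * t)) ⟩
    p * t / p                                          ≡⟨ [d*l]/d≡l p t ⟩
    t                                                  ∎)
    where
    open ≡-Reasoning
    j≡ : jIndex (j * c + p * t) ≡ j
    j≡ = jIndex-spec j<p (t , refl)

  good⇒splits : ∀ {μ} → GoodMultiplicity p r a m μ → ∃[ j ] ∃[ t ] j < p × t < m × μ ≡ j * c + p * t
  good⇒splits {μ} (j , j<p , μ%p≡ja%p , jc≤μ , μ≤jc+p[m-1])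
    with %-≡⇒∣∸ p jc≤μ (trans μ%p≡ja%p (sym (j*c%p≡j*a%p j)))
  ... | divides t μ∸jc≡t*p = j , t , j<p , t<m , μ≡
    where
    μ∸jc≡p*t : μ ∸ j * c ≡ p * t
    μ∸jc≡p*t = trans μ∸jc≡t*p (*-comm t p)
    μ≡ : μ ≡ j * c + p * t
    μ≡ = trans (sym (m+[n∸m]≡n jc≤μ)) (cong (j * c +_) μ∸jc≡p*t)
    t<m : t < m
    t<m = ≤∸1⇒< 1≤m (*-cancelˡ-≤ p (begin
      p * t                          ≡⟨ sym μ∸jc≡p*t ⟩
      μ ∸ j * c                      ≤⟨ ∸-monoˡ-≤ (j * c) μ≤jc+p[m-1] ⟩
      j * c + p * (m ∸ 1) ∸ j * c    ≡⟨ m+n∸m≡n (j * c) (p * (m ∸ 1)) ⟩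
      p * (m ∸ 1)                    ∎))
      where open ≤-Reasoning

  splits⇒good : ∀ {j t} → j < p → t < m → GoodMultiplicity p r a m (j * c + p * t)
  splits⇒good {j} {t} j<p t<m =
    j , j<p , trans (%-remove-+ʳ (j * c) (m∣m*n t)) (j*c%p≡j*a%p j) , m≤m+n (j * c) (p * t) ,
    +-monoʳ-≤ (j * c) (*-monoʳ-≤ p (<⇒≤∸1 t<m))

  good-decomposition : ∀ {μ} → GoodMultiplicity p r a m μ →
                       jIndex μ < p × tIndex μ < m × μ ≡ jIndex μ * c + p * tIndex μ
  good-decomposition μ-good with good⇒splits μ-good
  ... | j , t , j<p , t<m , refl with index-spec {j} {t} j<p
  ...   | j≡ , t≡ rewrite j≡ | t≡ = j<p , t<m , refl

  index-zero : jIndex 0 ≡ 0 × tIndex 0 ≡ 0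
  index-zero = subst (λ μ → jIndex μ ≡ 0 × tIndex μ ≡ 0) (*-zeroʳ p) (index-spec {0} {0} (>-nonZero⁻¹ p))

  merge : (ℕ → ℕ) → (ℕ → ℕ) → ℕ → ℕ
  merge A B x = dilate c A x + dilate p B x

  weight-merge : ∀ N A B → (∀ l → N < c * l → A l ≡ 0) → (∀ k → N < p * k → B k ≡ 0) →
                 weight N (merge A B) ≡ c * weight N A + p * weight N B
  weight-merge N A B A≡0 B≡0 = begin
    ∑ N (λ x → x * (dilate c A x + dilate p B x))                 ≡⟨ ∑-cong N (λ x _ → *-distribˡ-+ x (dilate c A x) (dilate p B x)) ⟩
    ∑ N (λ x → x * dilate c A x + x * dilate p B x)               ≡⟨ ∑-+ N _ _ ⟩
    weight N (dilate c A) + weight N (dilate p B)                 ≡⟨ cong₂ _+_ (weight-dilate c N A A≡0) (weight-dilate p N B B≡0) ⟩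
    c * weight N A + p * weight N B                               ∎
    where open ≡-Reasoning

  -- s = p − (l mod p) makes c l + s c = (l / p + 1) p c.
  c*l-good : ∀ {l} → ¬ p ∣ l → ∃[ s ] (1 ≤ s × s ≤ p ∸ 1 × (p * p * r + p * a) ∣ c * l + s * c)
  c*l-good {l} p∤l = p ∸ l % p , m<n⇒0<n∸m (m%n<n l p) , ∸-monoʳ-≤ p 1≤l%p , divides (l / p + 1) (begin
    c * l + (p ∸ l % p) * c                    ≡⟨ cong (_+ (p ∸ l % p) * c) (*-comm c l) ⟩
    l * c + (p ∸ l % p) * c                    ≡⟨ sym (*-distribʳ-+ c l (p ∸ l % p)) ⟩
    (l + (p ∸ l % p)) * c                      ≡⟨ cong (λ z → (z + (p ∸ l % p)) * c) (trans (m≡m%n+[m/n]*n l p) (+-comm (l % p) _)) ⟩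
    (l / p * p + l % p + (p ∸ l % p)) * c      ≡⟨ cong (_* c) (+-assoc (l / p * p) (l % p) _) ⟩
    (l / p * p + (l % p + (p ∸ l % p))) * c    ≡⟨ cong (λ z → (l / p * p + z) * c) (m+[n∸m]≡n (<⇒≤ (m%n<n l p))) ⟩
    (l / p * p + p) * c                        ≡⟨ cong (_* c) (cong (l / p * p +_) (sym (*-identityˡ p))) ⟩
    (l / p * p + 1 * p) * c                    ≡⟨ cong (_* c) (sym (*-distribʳ-+ p (l / p) 1)) ⟩
    (l / p + 1) * p * c                        ≡⟨ *-assoc (l / p + 1) p c ⟩
    (l / p + 1) * (p * c)                      ≡⟨ cong ((l / p + 1) *_) (sym p*p*r+p*a≡p*c) ⟩
    (l / p + 1) * (p * p * r + p * a)          ∎)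
    where
    open ≡-Reasoning
    1≤l%p : 1 ≤ l % p
    1≤l%p with l % p in l%p≡
    ... | zero  = contradiction (m%n≡0⇒n∣m l p l%p≡) p∤l
    ... | suc _ = s≤s z≤n

  dilate-c-on-multiples : ∀ {A} → (∀ l → p ∣ l → A l ≡ 0) → ∀ {x} → p ∣ x → dilate c A x ≡ 0
  dilate-c-on-multiples {A} A≡0 {x} p∣x with c ∣? x
  ... | yes c∣x = A≡0 (x / c) (p∣c*l⇒p∣l (subst (p ∣_) (sym (m*[n/m]≡n c∣x)) p∣x))
  ... | no  _   = refl

  merge-good : ∀ {A B} → (∀ l → p ∣ l → A l ≡ 0) → (∀ k → m ∣ k → B k ≡ 0) →
               ∀ x → 1 ≤ merge A B x → GoodPart p r a m x
  merge-good {A} {B} A≡0 B≡0 x 1≤e = on-p-multiples , off-p-multiples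
    where
    on-p-multiples : p ∣ x → ¬ (p * m ∣ x)
    on-p-multiples p∣x pm∣x = contradiction (subst (1 ≤_) e≡0 1≤e) λ ()
      where
      m∣x/p : m ∣ x / p
      m∣x/p = *-cancelˡ-∣ p (subst (p * m ∣_) (sym (m*[n/m]≡n p∣x)) pm∣x)
      e≡0 : merge A B x ≡ 0
      e≡0 = cong₂ _+_ (dilate-c-on-multiples A≡0 p∣x) (trans (dilate-∣ p B p∣x) (B≡0 (x / p) m∣x/p))
    off-p-multiples : ¬ p ∣ x → ∃[ s ] (1 ≤ s × s ≤ p ∸ 1 × (p * p * r + p * a) ∣ x + s * c)
    off-p-multiples p∤x with c ∣? x
    ... | no  c∤x = contradiction (subst (1 ≤_) (dilate-∤ p B p∤x) 1≤e) λ ()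
    ... | yes c∣x = subst (λ y → ∃[ s ] (1 ≤ s × s ≤ p ∸ 1 × (p * p * r + p * a) ∣ y + s * c)) (m*[n/m]≡n c∣x)
                          (c*l-good (λ p∣x/c → p∤x (subst (p ∣_) (m*[n/m]≡n c∣x) (∣n⇒∣m*n c p∣x/c))))

  cPart : (ℕ → ℕ) → ℕ → ℕ
  cPart e = dropMultiples p (e ∘ (c *_))

  pPart : (ℕ → ℕ) → ℕ → ℕ
  pPart e = e ∘ (p *_)

  merge-parts : ∀ {e} → (∀ x → 1 ≤ e x → GoodPart p r a m x) → e ≗ merge (cPart e) (pPart e)
  merge-parts {e} e-good x = by-divisibility (p ∣? x) (c ∣? x)
    where
    by-divisibility : Dec (p ∣ x) → Dec (c ∣ x) → e x ≡ merge (cPart e) (pPart e) x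
    by-divisibility (yes p∣x) _ =
      sym (cong₂ _+_ (dilate-c-on-multiples (λ l → dropMultiples-∣ p _) p∣x)
                     (trans (dilate-∣ p (pPart e) p∣x) (cong e (m*[n/m]≡n p∣x))))
    by-divisibility (no p∤x) (yes c∣x) =
      sym (trans (cong₂ _+_ (dilate-∣ c (cPart e) c∣x) (dilate-∤ p (pPart e) p∤x))
                 (trans (+-identityʳ _) (trans (dropMultiples-∤ p _ p∤x/c) (cong e (m*[n/m]≡n c∣x)))))
      where
      p∤x/c : ¬ p ∣ x / c
      p∤x/c p∣x/c = p∤x (subst (p ∣_) (m*[n/m]≡n c∣x) (∣n⇒∣m*n c p∣x/c))
    by-divisibility (no p∤x) (no c∤x) =
      trans absent (sym (cong₂ _+_ (dilate-∤ c (cPart e) c∤x) (dilate-∤ p (pPart e) p∤x)))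
      where
      absent : e x ≡ 0
      absent with e x in ex
      ... | zero  = refl
      ... | suc _ with proj₂ (e-good x (subst (1 ≤_) (sym ex) (s≤s z≤n))) p∤x
      ...   | s , _ , _ , pc∣x+sc =
        contradiction (∣m+n∣m⇒∣n (subst (c ∣_) (+-comm x (s * c)) (∣-trans (divides p p*p*r+p*a≡p*c) pc∣x+sc))
                                 (n∣m*n s)) c∤x

  cPart-merge : ∀ {A B} → (∀ l → p ∣ l → A l ≡ 0) → cPart (merge A B) ≗ A
  cPart-merge {A} {B} A≡0 l with p ∣? l
  ... | yes p∣l = sym (A≡0 l p∣l)
  ... | no  p∤l = trans (cong₂ _+_ (dilate-* c A l) (dilate-∤ p B (p∤l ∘ p∣c*l⇒p∣l))) (+-identityʳ (A l))

  pPart-merge : ∀ {A B} → (∀ l → p ∣ l → A l ≡ 0) → pPart (merge A B) ≗ B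
  pPart-merge {A} {B} A≡0 k = cong₂ _+_ (dilate-c-on-multiples A≡0 (m∣m*n k)) (dilate-* p B k)

  merge-cong : ∀ {A A′ B B′} → A ≗ A′ → B ≗ B′ → merge A B ≗ merge A′ B′
  merge-cong A≗A′ B≗B′ x = cong₂ _+_ (dilate-cong c A≗A′ x) (dilate-cong p B≗B′ x)

  cPart-cong : ∀ {e e′} → e ≗ e′ → cPart e ≗ cPart e′
  cPart-cong e≗e′ = dropMultiples-cong p (e≗e′ ∘ (c *_))

  merge-at-zero : ∀ {A B} → (∀ l → p ∣ l → A l ≡ 0) → B 0 ≡ 0 → merge A B 0 ≡ 0
  merge-at-zero {A} {B} A≡0 B0≡0 =
    cong₂ _+_ (dilate-c-on-multiples A≡0 (p ∣0)) (trans (dilate-∣ p B (p ∣0)) (trans (cong B (0/n≡0 p)) B0≡0))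

  merge-vanishes : ∀ {N A B} → (∀ l → N < c * l → A l ≡ 0) → (∀ k → N < p * k → B k ≡ 0) →
                   VanishesAbove N (merge A B)
  merge-vanishes A≡0 B≡0 x N<x = cong₂ _+_ (dilate-vanishes c A≡0 x N<x) (dilate-vanishes p B≡0 x N<x)

  record BMultiplicities (n : ℕ) (f : ℕ → ℕ) : Set where
    field
      isMultiplicities : IsMultiplicities n f
      good             : ∀ k → GoodMultiplicity p r a m (f k)

  record EMultiplicities (n : ℕ) (e : ℕ → ℕ) : Set where
    field
      isMultiplicities : IsMultiplicities n e
      good             : ∀ x → 1 ≤ e x → GoodPart p r a m x

  toE : ℕ → (ℕ → ℕ) → ℕ → ℕ
  toE n f = merge (P.glaisher n (jIndex ∘ f)) (M.glaisher n (tIndex ∘ f))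

  toB : ℕ → (ℕ → ℕ) → ℕ → ℕ
  toB n e k = P.unglaisher n (cPart e) k * c + p * M.unglaisher n (pPart e) k

  toE-cong : ∀ n {f f′} → f ≗ f′ → toE n f ≗ toE n f′
  toE-cong n f≗f′ = merge-cong (P.glaisher-cong n (cong jIndex ∘ f≗f′)) (M.glaisher-cong n (cong tIndex ∘ f≗f′))

  toB-cong : ∀ n {e e′} → e ≗ e′ → toB n e ≗ toB n e′
  toB-cong n e≗e′ k =
    cong₂ (λ j t → j * c + p * t) (P.unglaisher-cong n (cPart-cong e≗e′) k) (M.unglaisher-cong n (e≗e′ ∘ (p *_)) k)

  weight-combine : ∀ N J T → weight N (λ k → J k * c + p * T k) ≡ c * weight N J + p * weight N T
  weight-combine N J T = begin
    ∑ N (λ k → k * (J k * c + p * T k))              ≡⟨ ∑-cong N (λ k _ → distribute k (J k) c p (T k)) ⟩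
    ∑ N (λ k → c * (k * J k) + p * (k * T k))        ≡⟨ ∑-+ N _ _ ⟩
    ∑ N (λ k → c * (k * J k)) + ∑ N (λ k → p * (k * T k))  ≡⟨ cong₂ _+_ (∑-* N c _) (∑-* N p _) ⟩
    c * weight N J + p * weight N T                  ∎
    where
    open ≡-Reasoning
    distribute : ∀ k j c p t → k * (j * c + p * t) ≡ c * (k * j) + p * (k * t)
    distribute = solve-∀

  module _ {n f} (f-B : BMultiplicities n f) where
    open BMultiplicities f-B
    open IsMultiplicities isMultiplicities

    private
      J T Aᶜ Aᵖ : ℕ → ℕ
      J = jIndex ∘ f
      T = tIndex ∘ f
      Aᶜ = P.glaisher n J
      Aᵖ = M.glaisher n T

      f≡ : ∀ k → f k ≡ J k * c + p * T k
      f≡ k = proj₂ (proj₂ (good-decomposition (good k)))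

      index-vanishes : ∀ {k} → f k ≡ 0 → J k ≡ 0 × T k ≡ 0
      index-vanishes {k} fk≡0 = subst (λ μ → jIndex μ ≡ 0 × tIndex μ ≡ 0) (sym fk≡0) index-zero

      J-small : SmallMultiplicities p n J
      J-small = record
        { at-zero  = proj₁ (index-vanishes at-zero)
        ; vanishes = λ k n<k → proj₁ (index-vanishes (vanishes k n<k))
        ; below    = λ k → proj₁ (good-decomposition (good k))
        }

      T-small : SmallMultiplicities m n T
      T-small = record
        { at-zero  = proj₂ (index-vanishes at-zero)
        ; vanishes = λ k n<k → proj₂ (index-vanishes (vanishes k n<k))
        ; below    = λ k → proj₁ (proj₂ (good-decomposition (good k)))
        }

      weight-JT : c * weight n J + p * weight n T ≡ n
      weight-JT = trans (sym (weight-combine n J T)) (trans (sym (weight-cong n f≡)) weighs)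

      c*wJ≤n : c * weight n J ≤ n
      c*wJ≤n = subst (c * weight n J ≤_) weight-JT (m≤m+n _ _)

      p*wT≤n : p * weight n T ≤ n
      p*wT≤n = subst (p * weight n T ≤_) weight-JT (m≤n+m _ _)

      wJ≤n : weight n J ≤ n
      wJ≤n = ≤-trans (m≤n*m _ c) c*wJ≤n

      wT≤n : weight n T ≤ n
      wT≤n = ≤-trans (m≤n*m _ p) p*wT≤n

      weight-Aᶜ : weight n Aᶜ ≡ weight n J
      weight-Aᶜ = P.weight-glaisher J-small

      weight-Aᵖ : weight n Aᵖ ≡ weight n T
      weight-Aᵖ = M.weight-glaisher T-small

      Aᶜ-avoids : AvoidsMultiples p n Aᶜ
      Aᶜ-avoids = P.glaisher-avoids (SmallMultiplicities.vanishes J-small)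

      Aᵖ-avoids : AvoidsMultiples m n Aᵖ
      Aᵖ-avoids = M.glaisher-avoids (SmallMultiplicities.vanishes T-small)

      Aᶜ-far : ∀ l → n < c * l → Aᶜ l ≡ 0
      Aᶜ-far = weight-vanishes c (AvoidsMultiples.vanishes Aᶜ-avoids) (subst (λ w → c * w ≤ n) (sym weight-Aᶜ) c*wJ≤n)

      Aᵖ-far : ∀ k → n < p * k → Aᵖ k ≡ 0
      Aᵖ-far = weight-vanishes p (AvoidsMultiples.vanishes Aᵖ-avoids) (subst (λ w → p * w ≤ n) (sym weight-Aᵖ) p*wT≤n)

    toE-EMultiplicities : EMultiplicities n (toE n f)
    toE-EMultiplicities = record
      { isMultiplicities = record
        { at-zero  = merge-at-zero (AvoidsMultiples.on-multiples Aᶜ-avoids) (AvoidsMultiples.on-multiples Aᵖ-avoids 0 (m ∣0))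
        ; vanishes = merge-vanishes Aᶜ-far Aᵖ-far
        ; weighs   = trans (weight-merge n Aᶜ Aᵖ Aᶜ-far Aᵖ-far)
                           (trans (cong₂ (λ x y → c * x + p * y) weight-Aᶜ weight-Aᵖ) weight-JT)
        }
      ; good = merge-good (AvoidsMultiples.on-multiples Aᶜ-avoids) (AvoidsMultiples.on-multiples Aᵖ-avoids)
      }

    toB-toE : toB n (toE n f) ≗ f
    toB-toE k = begin
      P.unglaisher n (cPart (merge Aᶜ Aᵖ)) k * c + p * M.unglaisher n (pPart (merge Aᶜ Aᵖ)) k
        ≡⟨ cong₂ (λ j t → j * c + p * t) (P.unglaisher-cong n (cPart-merge on-p) k) (M.unglaisher-cong n (pPart-merge on-p) k) ⟩
      P.unglaisher n Aᶜ k * c + p * M.unglaisher n Aᵖ k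
        ≡⟨ cong₂ (λ j t → j * c + p * t) (P.unglaisher-glaisher J-small wJ≤n k) (M.unglaisher-glaisher T-small wT≤n k) ⟩
      J k * c + p * T k
        ≡⟨ sym (f≡ k) ⟩
      f k ∎
      where
      open ≡-Reasoning
      on-p = AvoidsMultiples.on-multiples Aᶜ-avoids

  module _ {n e} (e-E : EMultiplicities n e) where
    open EMultiplicities e-E
    open IsMultiplicities isMultiplicities

    private
      Aᶜ Aᵖ J T : ℕ → ℕ
      Aᶜ = cPart e
      Aᵖ = pPart e
      J = P.unglaisher n Aᶜ
      T = M.unglaisher n Aᵖ

      Aᶜ-far : ∀ l → n < c * l → Aᶜ l ≡ 0
      Aᶜ-far l n<cl = dropMultiples-≡0 p (vanishes (c * l) n<cl)

      Aᵖ-far : ∀ k → n < p * k → Aᵖ k ≡ 0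
      Aᵖ-far k = vanishes (p * k)

      Aᶜ-avoids : AvoidsMultiples p n Aᶜ
      Aᶜ-avoids = record
        { on-multiples = λ l → dropMultiples-∣ p _
        ; vanishes     = λ l n<l → Aᶜ-far l (<-≤-trans n<l (m≤n*m l c))
        }

      Aᵖ-avoids : AvoidsMultiples m n Aᵖ
      Aᵖ-avoids = record
        { on-multiples = on-m
        ; vanishes     = λ k n<k → Aᵖ-far k (<-≤-trans n<k (m≤n*m k p))
        }
        where
        on-m : ∀ k → m ∣ k → Aᵖ k ≡ 0
        on-m k m∣k with e (p * k) in ep
        ... | zero  = refl
        ... | suc _ = contradiction (*-monoʳ-∣ p m∣k)
                                    (proj₁ (good (p * k) (subst (1 ≤_) (sym ep) (s≤s z≤n))) (m∣m*n k))

      weight-parts : c * weight n Aᶜ + p * weight n Aᵖ ≡ n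
      weight-parts = trans (sym (weight-merge n Aᶜ Aᵖ Aᶜ-far Aᵖ-far)) (trans (sym (weight-cong n (merge-parts good))) weighs)

      wAᶜ≤n : weight n Aᶜ ≤ n
      wAᶜ≤n = ≤-trans (m≤n*m _ c) (subst (c * weight n Aᶜ ≤_) weight-parts (m≤m+n _ _))

      wAᵖ≤n : weight n Aᵖ ≤ n
      wAᵖ≤n = ≤-trans (m≤n*m _ p) (subst (p * weight n Aᵖ ≤_) weight-parts (m≤n+m _ _))

      J-small : SmallMultiplicities p n J
      J-small = P.unglaisher-small Aᶜ-avoids wAᶜ≤n

      T-small : SmallMultiplicities m n T
      T-small = M.unglaisher-small Aᵖ-avoids wAᵖ≤n

      glaisher-J : P.glaisher n J ≗ Aᶜ
      glaisher-J = P.glaisher-unglaisher Aᶜ-avoids wAᶜ≤n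

      glaisher-T : M.glaisher n T ≗ Aᵖ
      glaisher-T = M.glaisher-unglaisher Aᵖ-avoids wAᵖ≤n

      combine-≡0 : ∀ {j t} → j ≡ 0 → t ≡ 0 → j * c + p * t ≡ 0
      combine-≡0 refl refl = *-zeroʳ p

    toB-BMultiplicities : BMultiplicities n (toB n e)
    toB-BMultiplicities = record
      { isMultiplicities = record
        { at-zero  = combine-≡0 (SmallMultiplicities.at-zero J-small) (SmallMultiplicities.at-zero T-small)
        ; vanishes = λ k n<k → combine-≡0 (SmallMultiplicities.vanishes J-small k n<k)
                                          (SmallMultiplicities.vanishes T-small k n<k)
        ; weighs   = begin
            weight n (toB n e)                          ≡⟨ weight-combine n J T ⟩
            c * weight n J + p * weight n T             ≡⟨ cong₂ (λ x y → c * x + p * y) (weight-J) (weight-T) ⟩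
            c * weight n Aᶜ + p * weight n Aᵖ           ≡⟨ weight-parts ⟩
            n                                           ∎
        }
      ; good = λ k → splits⇒good (SmallMultiplicities.below J-small k) (SmallMultiplicities.below T-small k)
      }
      where
      open ≡-Reasoning
      weight-J : weight n J ≡ weight n Aᶜ
      weight-J = trans (sym (P.weight-glaisher J-small)) (weight-cong n glaisher-J)
      weight-T : weight n T ≡ weight n Aᵖ
      weight-T = trans (sym (M.weight-glaisher T-small)) (weight-cong n glaisher-T)

    toE-toB : toE n (toB n e) ≗ e
    toE-toB x = begin
      merge (P.glaisher n (jIndex ∘ toB n e)) (M.glaisher n (tIndex ∘ toB n e)) x
        ≡⟨ merge-cong (P.glaisher-cong n (proj₁ ∘ indices)) (M.glaisher-cong n (proj₂ ∘ indices)) x ⟩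
      merge (P.glaisher n J) (M.glaisher n T) x   ≡⟨ merge-cong glaisher-J glaisher-T x ⟩
      merge Aᶜ Aᵖ x                               ≡⟨ sym (merge-parts good x) ⟩
      e x                                         ∎
      where
      open ≡-Reasoning
      indices : ∀ k → jIndex (toB n e k) ≡ J k × tIndex (toB n e k) ≡ T k
      indices k = index-spec (SmallMultiplicities.below J-small k)

  module _ {n : ℕ} where

    B⇒multiplicities : (x : B p r a m n) → BMultiplicities n (multiplicities (partsB {p} {r} {a} {m} {n} x))
    B⇒multiplicities ((xs , xs-part) , xs-good) = record
      { isMultiplicities = multiplicities-isMultiplicities xs-part
      ; good             = good-at
      }
      where
      good-at : ∀ k → GoodMultiplicity p r a m (multiplicity k xs)
      good-at k with multiplicity k xs in μ≡
      ... | zero  = 0 , >-nonZero⁻¹ p , refl , z≤n , z≤n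
      ... | suc _ = subst (GoodMultiplicity p r a m) μ≡
                          (All.lookup xs-good (multiplicity-∈ xs (subst (1 ≤_) (sym μ≡) (s≤s z≤n))))

    E⇒multiplicities : (y : E p r a m n) → EMultiplicities n (multiplicities (partsE {p} {r} {a} {m} {n} y))
    E⇒multiplicities ((ys , ys-part) , ys-good) = record
      { isMultiplicities = multiplicities-isMultiplicities ys-part
      ; good             = λ x 1≤μ → All.lookup ys-good (multiplicity-∈ ys 1≤μ)
      }

    multiplicities⇒B : ∀ {f} → BMultiplicities n f → B p r a m n
    multiplicities⇒B {f} f-B = (partsOf n f , partsOf-isPartition isMultiplicities) ,
      All.tabulate (λ {k} _ → subst (GoodMultiplicity p r a m) (sym (multiplicity-partsOf n at-zero vanishes k)) (good k))
      where
      open BMultiplicities f-B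
      open IsMultiplicities isMultiplicities

    multiplicities⇒E : ∀ {e} → EMultiplicities n e → E p r a m n
    multiplicities⇒E {e} e-E = (partsOf n e , partsOf-isPartition isMultiplicities) ,
      All.tabulate (λ {x} x∈ → good x (subst (1 ≤_) (multiplicity-partsOf n at-zero vanishes x) (∈-multiplicity x∈)))
      where
      open EMultiplicities e-E
      open IsMultiplicities isMultiplicities

    B→E : B p r a m n → E p r a m n
    B→E x = multiplicities⇒E (toE-EMultiplicities (B⇒multiplicities x))

    E→B : E p r a m n → B p r a m n
    E→B y = multiplicities⇒B (toB-BMultiplicities (E⇒multiplicities y))

    E→B-B→E : ∀ x → partsB {p} {r} {a} {m} {n} (E→B (B→E x)) ≡ partsB {p} {r} {a} {m} {n} x
    E→B-B→E x@((xs , xs-part) , _) = begin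
      partsOf n (toB n (multiplicities (partsOf n (toE n f))))   ≡⟨ partsOf-cong n (toB-cong n (multiplicity-partsOf n at-zero vanishes)) ⟩
      partsOf n (toB n (toE n f))                               ≡⟨ partsOf-cong n (toB-toE f-B) ⟩
      partsOf n f                                               ≡⟨ partsOf-multiplicities xs-part ⟩
      xs                                                        ∎
      where
      open ≡-Reasoning
      f : ℕ → ℕ
      f = multiplicities xs
      f-B : BMultiplicities n f
      f-B = B⇒multiplicities x
      open IsMultiplicities (EMultiplicities.isMultiplicities (toE-EMultiplicities f-B))

    B→E-E→B : ∀ y → partsE {p} {r} {a} {m} {n} (B→E (E→B y)) ≡ partsE {p} {r} {a} {m} {n} y
    B→E-E→B y@((ys , ys-part) , _) = begin
      partsOf n (toE n (multiplicities (partsOf n (toB n e))))   ≡⟨ partsOf-cong n (toE-cong n (multiplicity-partsOf n at-zero vanishes)) ⟩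
      partsOf n (toE n (toB n e))                               ≡⟨ partsOf-cong n (toE-toB e-E) ⟩
      partsOf n e                                               ≡⟨ partsOf-multiplicities ys-part ⟩
      ys                                                        ∎
      where
      open ≡-Reasoning
      e : ℕ → ℕ
      e = multiplicities ys
      e-E : EMultiplicities n e
      e-E = E⇒multiplicities y
      open IsMultiplicities (BMultiplicities.isMultiplicities (toB-BMultiplicities e-E))

theorem4 : (p a r m : ℕ) → .{{_ : NonZero p}} → 1 ≤ a → Coprime a p → 1 ≤ m →
           (n : ℕ) → Equinumerous (partsB {p} {r} {a} {m} {n}) (partsE {p} {r} {a} {m} {n})
theorem4 p a r m 1≤a a⊥p 1≤m n = record
  { to        = B→E
  ; from      = E→B
  ; to-cong   = λ _ _ → cong (λ xs → partsOf n (toE n (multiplicities xs)))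
  ; from-cong = λ _ _ → cong (λ ys → partsOf n (toB n (multiplicities ys)))
  ; from-to   = E→B-B→E
  ; to-from   = B→E-E→B
  }
  where open Correspondence p r a m 1≤a a⊥p 1≤m
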